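{- Let $a,b\ge 0$ be integers and let $G$ be an SP-game with legal complex $\Delta_G=\langle\{x_0,\dots,x_a\},\{y_0,\dots,y_b\}\rangle$, where the $x_i$ are Left vertices and the $y_j$ are Right vertices. Then $G$ has value $\{a\mid -b\}$.
   Context: Games are two-player (Left, Right) short combinatorial games under normal play; $\{A\mid B\}$ denotes the game with Left options $A$ and Right options $B$; value means game value (equivalence class under $G=H$ iff $G-H$ is a second-player win). An SP-game is a placement game on an initially empty board in which pieces are never moved or removed and in which any sequence of moves leading to a reachable position consists of legal moves. Its legal complex $\Delta_G$ has one vertex per basic position (single-piece position), Left basic positions written $x_i$ and Right ones $y_j$, with a set of vertices a face iff the corresponding pieces together form a legal position; from the position corresponding to face $F$, Left (resp. Right) may move to $F\cup\{v\}$ for any Left (resp. Right) vertex $v\notin F$ with $F\cup\{v\}\in\Delta_G$. $\langle F_1,\dots,F_k\rangle$ is the simplicial complex with facets $F_1,\dots,F_k$. Integers as games: $0=\{\,\mid\,\}$, $n=\{n-1\mid\,\}$ for $n>0$, $n=\{\,\mid n+1\}$ for $n<0$. -}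

module Defs where

open import Data.Nat using (ℕ; zero; suc; _+_)
open import Data.Fin using (Fin; splitAt)
open import Data.Fin.Subset using (Subset; _∈_; _∉_; _∪_; ⁅_⁆; ⊥)
open import Data.Product using (Σ; _×_; _,_)
open import Data.Sum using (_⊎_; inj₁; inj₂)
open import Data.Unit using (⊤; tt)
open import Data.Empty renaming (⊥ to Empty)
open import Relation.Binary.PropositionalEquality using (_≡_)

-- Combinatorial games: Left options indexed by L, Right options by R.

data Game : Set₁ where
  mk : (L R : Set) → (L → Game) → (R → Game) → Game

zeroG : Game
zeroG = mk Empty Empty (λ ()) (λ ())

negG : Game → Game
negG (mk L R gl gr) = mk R L (λ j → negG (gr j)) (λ i → negG (gl i))

infixl 6 _⊕_
_⊕_ : Game → Game → Game
G ⊕ H = mk (leftIx G ⊎ leftIx H) (rightIx G ⊎ rightIx H) (lopt G H) (ropt G H)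
  where
  leftIx rightIx : Game → Set
  leftIx  (mk L R gl gr) = L
  rightIx (mk L R gl gr) = R
  lopt : (G H : Game) → leftIx G ⊎ leftIx H → Game
  ropt : (G H : Game) → rightIx G ⊎ rightIx H → Game
  lopt (mk L R gl gr) H (inj₁ i) = gl i ⊕ H
  lopt G (mk L R hl hr) (inj₂ i) = G ⊕ hl i
  ropt (mk L R gl gr) H (inj₁ j) = gr j ⊕ H
  ropt G (mk L R hl hr) (inj₂ j) = G ⊕ hr j

-- Normal play: who wins moving first / second.
LFirst LSecond RFirst RSecond : Game → Set
LFirst  (mk L R gl gr) = Σ L λ i → LSecond (gl i)
LSecond (mk L R gl gr) = (j : R) → LFirst (gr j)
RFirst  (mk L R gl gr) = Σ R λ j → RSecond (gr j)
RSecond (mk L R gl gr) = (i : L) → RFirst (gl i)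

SecondPlayerWin : Game → Set
SecondPlayerWin G = LSecond G × RSecond G

infix 4 _≈G_
_≈G_ : Game → Game → Set
G ≈G H = SecondPlayerWin (G ⊕ negG H)

natG : ℕ → Game
natG zero    = zeroG
natG (suc n) = mk ⊤ Empty (λ _ → natG n) (λ ())

negNatG : ℕ → Game
negNatG zero    = zeroG
negNatG (suc n) = mk Empty ⊤ (λ ()) (λ _ → negNatG n)

⟨_∣_⟩ : Game → Game → Game
⟨ G ∣ H ⟩ = mk ⊤ ⊤ (λ _ → G) (λ _ → H)

data Player : Set where
  Left Right : Player

-- vertices Fin n (basic positions), each owned by a player;
-- IsFace F : F is a legal position (face of the legal complex)
record LegalComplex (n : ℕ) : Set₁ where
  field
    owner  : Fin n → Player
    IsFace : Subset n → Set

module _ {n : ℕ} (C : LegalComplex n) where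
  open LegalComplex C

  -- game from the position F; the fuel k bounds the remaining depth
  -- (every move adds a new vertex, so fuel n from ∅ is never exhausted
  -- while moves remain)
  positionGame : ℕ → Subset n → Game
  positionGame zero    F = zeroG
  positionGame (suc k) F =
    mk (Σ (Fin n) λ v → owner v ≡ Left  × v ∉ F × IsFace (F ∪ ⁅ v ⁆))
       (Σ (Fin n) λ v → owner v ≡ Right × v ∉ F × IsFace (F ∪ ⁅ v ⁆))
       (λ { (v , _) → positionGame k (F ∪ ⁅ v ⁆) })
       (λ { (v , _) → positionGame k (F ∪ ⁅ v ⁆) })

  spGame : Game
  spGame = positionGame n ⊥

-- The complex ⟨{x_0..x_a},{y_0..y_b}⟩: vertices Fin (suc a + suc b),
-- the first suc a are Left (x_i), the remaining suc b are Right (y_j).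

ownerXY : (a b : ℕ) → Fin (suc a + suc b) → Player
ownerXY a b v with splitAt (suc a) v
... | inj₁ _ = Left
... | inj₂ _ = Right

complexXY : (a b : ℕ) → LegalComplex (suc a + suc b)
complexXY a b = record
  { owner  = ownerXY a b
  ; IsFace = λ F → ((v : Fin (suc a + suc b)) → v ∈ F → ownerXY a b v ≡ Left)
                 ⊎ ((v : Fin (suc a + suc b)) → v ∈ F → ownerXY a b v ≡ Right)
  }

-- After the first move the board is a nonempty face inside one of the two simplices,
-- so from then on only the player who moved can move, and exactly once per unplayed
-- vertex of their simplex: the rest of the game is the integer a (after a Left move)
-- or -b (after a Right move). A game whose options are matched, side by side, by
-- equal options of another game is equal to it, hence G = {a | -b}.
module Submission where

open import Defs
open import Data.Nat using (ℕ; zero; suc; _+_; _≤_; z≤n; s≤s)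
open import Data.Nat.Properties using (+-suc; suc-injective; m+n≡0⇒m≡0; m+n≡0⇒n≡0; m≤m+n; m≤n+m; n≤1+n; ≤-trans)
open import Data.Fin using (Fin; zero; suc; splitAt)
open import Data.Fin.Subset using (Subset; Nonempty; _∈_; _∉_; _∪_; ⁅_⁆; ⊥; inside; outside)
open import Data.Fin.Subset.Properties using (∉⊥; x∈⁅x⁆; x∈⁅y⁆⇒x≡y; x∈p∪q⁻; x∈p∪q⁺; ∪-identityʳ)
open import Data.Vec.Base using (_∷_; []; here; there)
open import Data.Product using (Σ; ∃; _×_; _,_; proj₁; proj₂)
open import Data.Sum using (inj₁; inj₂; [_,_]′)
open import Data.Sum.Properties using ([,]-map)
open import Data.Unit using (⊤; tt)
open import Data.Empty using (⊥-elim)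
open import Function using (_∘_; const)
open import Relation.Binary.Definitions using (DecidableEquality)
open import Relation.Binary.PropositionalEquality using (_≡_; _≢_; _≗_; refl; sym; trans; cong; subst)
open import Relation.Nullary using (¬_; yes; no; contradiction)

LFirst-⊕ʳ : ∀ G {L R} {hl : L → Game} {hr : R → Game} i →
            LSecond (G ⊕ hl i) → LFirst (G ⊕ mk L R hl hr)
LFirst-⊕ʳ (mk _ _ _ _) i win = inj₂ i , win

RFirst-⊕ʳ : ∀ G {L R} {hl : L → Game} {hr : R → Game} j →
            RSecond (G ⊕ hr j) → RFirst (G ⊕ mk L R hl hr)
RFirst-⊕ʳ (mk _ _ _ _) j win = inj₂ j , win

OptionsMatch : {A B : Set} → (A → Game) → (B → Game) → Set
OptionsMatch {A} {B} f g = (∀ i → Σ B λ j → f i ≈G g j) × (∀ j → Σ A λ i → f i ≈G g j)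

emptyOptionsMatch : {A B : Set} {f : A → Game} {g : B → Game} → ¬ A → ¬ B → OptionsMatch f g
emptyOptionsMatch ¬A ¬B = ⊥-elim ∘ ¬A , ⊥-elim ∘ ¬B

-- In G - H every move is answered by the matching move in the other component.
matchingOptions⇒≈G : ∀ {L R L′ R′} {gl : L → Game} {gr : R → Game} {hl : L′ → Game} {hr : R′ → Game} →
                     OptionsMatch gl hl → OptionsMatch gr hr → mk L R gl gr ≈G mk L′ R′ hl hr
matchingOptions⇒≈G {L} {R} {L′} {R′} {gl} {gr} {hl} {hr} (matchL , matchL′) (matchR , matchR′) =
  lSecond , rSecond
  where
  lSecond : LSecond (mk L R gl gr ⊕ negG (mk L′ R′ hl hr))
  lSecond (inj₁ j)  = let j′ , e = matchR j   in LFirst-⊕ʳ (gr j) j′ (proj₁ e)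
  lSecond (inj₂ i′) = let i  , e = matchL′ i′ in inj₁ i , proj₁ e
  rSecond : RSecond (mk L R gl gr ⊕ negG (mk L′ R′ hl hr))
  rSecond (inj₁ i)  = let i′ , e = matchL i   in RFirst-⊕ʳ (gl i) i′ (proj₂ e)
  rSecond (inj₂ j′) = let j  , e = matchR′ j′ in inj₁ j , proj₂ e

zeroG≈zeroG : zeroG ≈G zeroG
zeroG≈zeroG = matchingOptions⇒≈G (emptyOptionsMatch (λ ()) (λ ())) (emptyOptionsMatch (λ ()) (λ ()))

signedNatG : Player → ℕ → Game
signedNatG Left  = natG
signedNatG Right = negNatG

_≟ₚ_ : DecidableEquality Player
Left  ≟ₚ Left  = yes refl
Left  ≟ₚ Right = no λ ()
Right ≟ₚ Left  = no λ ()
Right ≟ₚ Right = yes refl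

δ : Player → Player → ℕ
δ Left  Left  = 1
δ Right Right = 1
δ Left  Right = 0
δ Right Left  = 0

δ-refl : ∀ p → δ p p ≡ 1
δ-refl Left  = refl
δ-refl Right = refl

δ-≢ : ∀ {q p} → q ≢ p → δ q p ≡ 0
δ-≢ {Left}  {Left}  q≢p = contradiction refl q≢p
δ-≢ {Left}  {Right} q≢p = refl
δ-≢ {Right} {Left}  q≢p = refl
δ-≢ {Right} {Right} q≢p = contradiction refl q≢p

∃∉-there : ∀ {n} {o : Fin (suc n) → Player} {p s F} →
           (∃ λ v → o (suc v) ≡ p × v ∉ F) → ∃ λ v → o v ≡ p × v ∉ s ∷ F
∃∉-there (v , ov , v∉F) = suc v , ov , λ { (there v∈F) → v∉F v∈F }

unplayed : ∀ {n} → (Fin n → Player) → Player → Subset n → ℕ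
unplayed o p []            = 0
unplayed o p (inside  ∷ F) = unplayed (o ∘ suc) p F
unplayed o p (outside ∷ F) = δ (o zero) p + unplayed (o ∘ suc) p F

unplayed-cong : ∀ {n} {o o′ : Fin n → Player} {p} (F : Subset n) → o ≗ o′ →
                unplayed o p F ≡ unplayed o′ p F
unplayed-cong []            o≗o′ = refl
unplayed-cong (inside  ∷ F) o≗o′ = unplayed-cong F (o≗o′ ∘ suc)
unplayed-cong (outside ∷ F) o≗o′ rewrite o≗o′ zero = cong (_ +_) (unplayed-cong F (o≗o′ ∘ suc))

unplayed≡0⇒∈ : ∀ {n} {o : Fin n → Player} {p F v} → unplayed o p F ≡ 0 → o v ≡ p → v ∈ F
unplayed≡0⇒∈ {F = inside ∷ F} {zero} _ _ = here
unplayed≡0⇒∈ {o = o} {F = outside ∷ F} {zero} u≡0 refl =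
  contradiction (trans (sym (δ-refl (o zero))) (m+n≡0⇒m≡0 _ u≡0)) λ ()
unplayed≡0⇒∈ {F = inside ∷ F} {suc v} u≡0 ov = there (unplayed≡0⇒∈ u≡0 ov)
unplayed≡0⇒∈ {o = o} {F = outside ∷ F} {suc v} u≡0 ov =
  there (unplayed≡0⇒∈ (m+n≡0⇒n≡0 (δ (o zero) _) u≡0) ov)

unplayed≡suc⇒∃∉ : ∀ {n} {o : Fin n → Player} {p F m} → unplayed o p F ≡ suc m →
                  ∃ λ v → o v ≡ p × v ∉ F
unplayed≡suc⇒∃∉ {F = []} ()
unplayed≡suc⇒∃∉ {F = inside ∷ F} u≡1+m = ∃∉-there (unplayed≡suc⇒∃∉ u≡1+m)
unplayed≡suc⇒∃∉ {o = o} {p} {F = outside ∷ F} {m} u≡1+m with o zero ≟ₚ p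
... | yes o₀≡p = zero , o₀≡p , λ ()
... | no  o₀≢p =
  ∃∉-there (unplayed≡suc⇒∃∉ (subst (λ d → d + unplayed (o ∘ suc) p F ≡ suc m) (δ-≢ o₀≢p) u≡1+m))

unplayed-∪⁅⁆ : ∀ {n} {o : Fin n → Player} {p F v} → o v ≡ p → v ∉ F →
               unplayed o p F ≡ suc (unplayed o p (F ∪ ⁅ v ⁆))
unplayed-∪⁅⁆ {F = inside  ∷ F} {zero}  refl v∉F = contradiction here v∉F
unplayed-∪⁅⁆ {o = o} {F = outside ∷ F} {zero}  refl v∉F
  rewrite δ-refl (o zero) | ∪-identityʳ F = refl
unplayed-∪⁅⁆ {F = inside  ∷ F} {suc v} ov v∉F = unplayed-∪⁅⁆ ov (v∉F ∘ there)
unplayed-∪⁅⁆ {o = o} {F = outside ∷ F} {suc v} ov v∉F =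
  trans (cong (δ (o zero) _ +_) (unplayed-∪⁅⁆ ov (v∉F ∘ there))) (+-suc _ _)

unplayed-const-≢ : ∀ {n} {q p : Player} (F : Subset n) → q ≢ p → unplayed (λ _ → q) p F ≡ 0
unplayed-const-≢ []            q≢p = refl
unplayed-const-≢ (inside  ∷ F) q≢p = unplayed-const-≢ F q≢p
unplayed-const-≢ (outside ∷ F) q≢p rewrite δ-≢ q≢p = unplayed-const-≢ F q≢p

unplayed-const-⊥ : ∀ n p → unplayed (λ (_ : Fin n) → p) p ⊥ ≡ n
unplayed-const-⊥ zero    p = refl
unplayed-const-⊥ (suc n) p rewrite δ-refl p = cong suc (unplayed-const-⊥ n p)

x∈p∪⁅x⁆ : ∀ {n} (p : Subset n) x → x ∈ p ∪ ⁅ x ⁆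
x∈p∪⁅x⁆ p x = x∈p∪q⁺ (inj₂ (x∈⁅x⁆ x))

blockOwner : ∀ m n → Fin (m + n) → Player
blockOwner m n = [ const Left , const Right ]′ ∘ splitAt m

blockOwner-suc : ∀ m n (i : Fin (m + n)) → blockOwner (suc m) n (suc i) ≡ blockOwner m n i
blockOwner-suc m n i = [,]-map (splitAt m i)

unplayed-blockOwner-Left : ∀ m n → unplayed (blockOwner m n) Left ⊥ ≡ m
unplayed-blockOwner-Left zero    n = unplayed-const-≢ (⊥ {n}) λ ()
unplayed-blockOwner-Left (suc m) n =
  cong suc (trans (unplayed-cong ⊥ (blockOwner-suc m n)) (unplayed-blockOwner-Left m n))

unplayed-blockOwner-Right : ∀ m n → unplayed (blockOwner m n) Right ⊥ ≡ n
unplayed-blockOwner-Right zero    n = unplayed-const-⊥ n Right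
unplayed-blockOwner-Right (suc m) n =
  trans (unplayed-cong ⊥ (blockOwner-suc m n)) (unplayed-blockOwner-Right m n)

ownerXY≗blockOwner : ∀ a b → ownerXY a b ≗ blockOwner (suc a) (suc b)
ownerXY≗blockOwner a b v with splitAt (suc a) v
... | inj₁ _ = refl
... | inj₂ _ = refl

module TwoSimplices (a b : ℕ) where

  C : LegalComplex (suc a + suc b)
  C = complexXY a b

  open LegalComplex C using (owner; IsFace)

  PureFace : Player → Subset (suc a + suc b) → Set
  PureFace p F = ∀ v → v ∈ F → owner v ≡ p

  LegalMove : Player → Subset (suc a + suc b) → Set
  LegalMove p F = Σ (Fin (suc a + suc b)) λ v → owner v ≡ p × v ∉ F × IsFace (F ∪ ⁅ v ⁆)

  pure-⊥ : ∀ {p} → PureFace p ⊥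
  pure-⊥ v v∈⊥ = contradiction v∈⊥ ∉⊥

  pure-∪⁅⁆ : ∀ {p F v} → PureFace p F → owner v ≡ p → PureFace p (F ∪ ⁅ v ⁆)
  pure-∪⁅⁆ {F = F} {v} pure ov u u∈ with x∈p∪q⁻ F ⁅ v ⁆ u∈
  ... | inj₁ u∈F = pure u u∈F
  ... | inj₂ u∈v = subst (λ w → owner w ≡ _) (sym (x∈⁅y⁆⇒x≡y v u∈v)) ov

  pure⇒face : ∀ {p F} → PureFace p F → IsFace F
  pure⇒face {Left}  = inj₁
  pure⇒face {Right} = inj₂

  face-monochromatic : ∀ {G u w} → IsFace G → u ∈ G → w ∈ G → owner u ≡ owner w
  face-monochromatic (inj₁ pure) u∈G w∈G = trans (pure _ u∈G) (sym (pure _ w∈G))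
  face-monochromatic (inj₂ pure) u∈G w∈G = trans (pure _ u∈G) (sym (pure _ w∈G))

  opponentStuck : ∀ {p q F} → PureFace p F → Nonempty F → p ≢ q → ¬ LegalMove q F
  opponentStuck {F = F} pure (u , u∈F) p≢q (v , ov , _ , face) =
    p≢q (trans (sym (pure u u∈F))
               (trans (face-monochromatic face (x∈p∪q⁺ (inj₁ u∈F)) (x∈p∪⁅x⁆ F v)) ov))

  unplayed≡0⇒stuck : ∀ {p F} → unplayed owner p F ≡ 0 → ¬ LegalMove p F
  unplayed≡0⇒stuck u≡0 (v , ov , v∉F , _) = v∉F (unplayed≡0⇒∈ u≡0 ov)

  unplayedMove : ∀ p {F m} → PureFace p F → unplayed owner p F ≡ suc m → LegalMove p F
  unplayedMove p pure u≡1+m =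
    let v , ov , v∉F = unplayed≡suc⇒∃∉ u≡1+m in v , ov , v∉F , pure⇒face (pure-∪⁅⁆ pure ov)

  mutual
    pure-position-≈ : ∀ p k {m F} → m ≤ k → PureFace p F → Nonempty F → unplayed owner p F ≡ m →
                      positionGame C k F ≈G signedNatG p m
    pure-position-≈ Left  zero z≤n _ _ _ = zeroG≈zeroG
    pure-position-≈ Right zero z≤n _ _ _ = zeroG≈zeroG
    pure-position-≈ Left  (suc k) {zero} _ pure nonempty u≡0 =
      matchingOptions⇒≈G (emptyOptionsMatch (unplayed≡0⇒stuck u≡0) λ ())
                         (emptyOptionsMatch (opponentStuck pure nonempty λ ()) λ ())
    pure-position-≈ Right (suc k) {zero} _ pure nonempty u≡0 =
      matchingOptions⇒≈G (emptyOptionsMatch (opponentStuck pure nonempty λ ()) λ ())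
                         (emptyOptionsMatch (unplayed≡0⇒stuck u≡0) λ ())
    pure-position-≈ Left  (suc k) {suc m} (s≤s m≤k) pure nonempty u≡1+m =
      matchingOptions⇒≈G (legalMovesMatch Left m≤k pure u≡1+m)
                         (emptyOptionsMatch (opponentStuck pure nonempty λ ()) λ ())
    pure-position-≈ Right (suc k) {suc m} (s≤s m≤k) pure nonempty u≡1+m =
      matchingOptions⇒≈G (emptyOptionsMatch (opponentStuck pure nonempty λ ()) λ ())
                         (legalMovesMatch Right m≤k pure u≡1+m)

    legalMovesMatch : ∀ p {k m F} → m ≤ k → PureFace p F → unplayed owner p F ≡ suc m →
                      OptionsMatch (λ ((v , _) : LegalMove p F) → positionGame C k (F ∪ ⁅ v ⁆))
                                   (λ (_ : ⊤) → signedNatG p m)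
    legalMovesMatch p {k} {F = F} m≤k pure u≡1+m =
      (λ i → tt , afterMove i) , (λ _ → move , afterMove move)
      where
      move : LegalMove p F
      move = unplayedMove p pure u≡1+m
      afterMove : ((v , _) : LegalMove p F) → positionGame C k (F ∪ ⁅ v ⁆) ≈G signedNatG p _
      afterMove (v , ov , v∉F , _) =
        pure-position-≈ p k m≤k (pure-∪⁅⁆ pure ov) (v , x∈p∪⁅x⁆ F v)
                        (suc-injective (trans (sym (unplayed-∪⁅⁆ ov v∉F)) u≡1+m))

  unplayed-⊥-Left : unplayed owner Left ⊥ ≡ suc a
  unplayed-⊥-Left =
    trans (unplayed-cong {p = Left} ⊥ (ownerXY≗blockOwner a b)) (unplayed-blockOwner-Left (suc a) (suc b))

  unplayed-⊥-Right : unplayed owner Right ⊥ ≡ suc b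
  unplayed-⊥-Right =
    trans (unplayed-cong {p = Right} ⊥ (ownerXY≗blockOwner a b)) (unplayed-blockOwner-Right (suc a) (suc b))

mainTheorem9 : (a b : ℕ) → spGame (complexXY a b) ≈G ⟨ natG a ∣ negNatG b ⟩
mainTheorem9 a b =
  matchingOptions⇒≈G (legalMovesMatch Left  (m≤m+n a (suc b))                    pure-⊥ unplayed-⊥-Left)
                     (legalMovesMatch Right (≤-trans (n≤1+n b) (m≤n+m (suc b) a)) pure-⊥ unplayed-⊥-Right)
  where open TwoSimplices a b
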